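{- Let $k,m$ be positive integers, $n=k+m$, let $Q$ be the complete bipartite poset of type $(k,m)$, $A=\{x_{k+1},\dots,x_n\}$ and $M=\mathbf{I}(Q,A)$. Let $X=\begin{bmatrix}\mathbf{1}_k&B_X\\0&T_X\end{bmatrix}\in M$ with $T_X\in\overline{\mathbf{T}}_L$ for some $L$ with $[k]\subseteq L\subseteq[n]$. Then: (1) $J_X=D_X=R_X=\left\{\begin{bmatrix}\mathbf{1}_k&B\\0&D\end{bmatrix}\in M: D\in\overline{\mathbf{T}}_L\right\}=J_{\mathbf{1}_L}$; (2) $L_X=H_X=\left\{\begin{bmatrix}\mathbf{1}_k&B\\0&D\end{bmatrix}\in M: B(\mathbf{1}_m-\widetilde{\mathbf{1}_L})=B_X(\mathbf{1}_m-\widetilde{\mathbf{1}_L})\text{ and }D\in\overline{\mathbf{T}}_L\right\}$; (3) $J_X$ is a right group.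
   Context: Work over $\mathbb{C}$. The complete bipartite poset of type $(k,m)$ is $Q=\{x_1,\dots,x_n\}$ with $x_i<x_j$ iff $i\le k<j$, no other strict relations. $M=\mathbf{I}(Q,A)=\{\begin{bmatrix}\mathbf{1}_k&B\\0&D\end{bmatrix}: B\in\mathrm{Mat}_{k,m},\ D\text{ diagonal }m\times m\}$ is the Zariski closure of $\mathbf{T}_n(A)\ltimes\mathbf{U}_n(Q)$ (invertible diagonal matrices with first $k$ entries $1$, times upper unitriangular matrices supported on the relations of $Q$). For $L\subseteq[n]$, $\mathbf{1}_L=\mathrm{diag}(a_1,\dots,a_n)$ with $a_j=1$ if $j\in L$ and $0$ otherwise; $\widetilde{\mathbf{1}_L}=\mathrm{diag}(a_{k+1},\dots,a_n)$; $\overline{\mathbf{T}}_L$ is the set of $m\times m$ diagonal matrices $D$ with $D=D'\widetilde{\mathbf{1}_L}$ for some invertible diagonal $D'$. $J_X,D_X,R_X,L_X,H_X$ denote the Green's $\mathcal{J},\mathcal{D},\mathcal{R},\mathcal{L},\mathcal{H}$-classes of $X$ in $M$ ($a\mathcal{R}b$ iff $aM=bM$; $a\mathcal{L}b$ iff $Ma=Mb$; $a\mathcal{J}b$ iff $MaM=MbM$; $\mathcal{H}=\mathcal{R}\cap\mathcal{L}$; $a\mathcal{D}b$ iff $a\mathcal{R}c\mathcal{L}b$ for some $c$). A right group is a semigroup that is right simple (all elements $\mathcal{R}$-related) and left cancellative. -}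

module Defs where

open import Level using (Level; _⊔_)
open import Algebra.Bundles using (CommutativeRing)
open import Data.Nat using (ℕ)
open import Data.Fin using (Fin; _↑ˡ_; _↑ʳ_)
open import Data.Fin.Subset using (Subset; _∈_)
open import Data.Vec using (lookup)
open import Data.Bool using (if_then_else_)
open import Data.Product using (Σ; ∃; _×_; _,_)
open import Data.Sum using (_⊎_)
open import Relation.Nullary using (¬_)
open import Function.Bundles using (_⇔_)

IsField : ∀ {c ℓ} → CommutativeRing c ℓ → Set (c ⊔ ℓ)
IsField R = (¬ (0# ≈ 1#)) × (∀ x → ¬ (x ≈ 0#) → ∃ λ y → x * y ≈ 1#)
  where open CommutativeRing R

module Bipartite {c ℓ} (R : CommutativeRing c ℓ) (k m : ℕ) where
  open CommutativeRing R renaming (Carrier to F)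

  -- An element  [ 1_k  B ; 0  diag(d) ]  of  M = I(Q,A)  (Q complete bipartite
  -- of type (k,m)) is determined by the k×m block B and the diagonal d of D.
  record Elt : Set c where
    constructor ⟦_,_⟧
    field
      blk : Fin k → Fin m → F
      dia : Fin m → F
  open Elt public

  -- Block matrix product:
  -- [1 B;0 D][1 B';0 D'] = [1 (B' + B D'); 0 (D D')]   (D' diagonal).
  _·_ : Elt → Elt → Elt
  X · Y = ⟦ (λ i j → blk Y i j + blk X i j * dia Y j) , (λ j → dia X j * dia Y j) ⟧

  _≋_ : Elt → Elt → Set ℓ
  X ≋ Y = (∀ i j → blk X i j ≈ blk Y i j) × (∀ j → dia X j ≈ dia Y j)

  _𝓡_ : Elt → Elt → Set (c ⊔ ℓ)
  a 𝓡 b = ∀ x → (∃ λ u → x ≋ (a · u)) ⇔ (∃ λ v → x ≋ (b · v))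

  _𝓛_ : Elt → Elt → Set (c ⊔ ℓ)
  a 𝓛 b = ∀ x → (∃ λ u → x ≋ (u · a)) ⇔ (∃ λ v → x ≋ (v · b))

  _𝓙_ : Elt → Elt → Set (c ⊔ ℓ)
  a 𝓙 b = ∀ x → (∃ λ u → ∃ λ v → x ≋ ((u · a) · v))
               ⇔ (∃ λ u → ∃ λ v → x ≋ ((u · b) · v))

  _𝓗_ : Elt → Elt → Set (c ⊔ ℓ)
  a 𝓗 b = (a 𝓡 b) × (a 𝓛 b)

  _𝓓_ : Elt → Elt → Set (c ⊔ ℓ)
  a 𝓓 b = ∃ λ c′ → (a 𝓡 c′) × (c′ 𝓛 b)

  ContainsTop : Subset (k Data.Nat.+ m) → Set
  ContainsTop L = ∀ (i : Fin k) → (i ↑ˡ m) ∈ L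

  -- diagonal of  \widetilde{1_L}  (entries a_{k+1},…,a_n)
  𝟙̃ : Subset (k Data.Nat.+ m) → Fin m → F
  𝟙̃ L j = if lookup L (k ↑ʳ j) then 1# else 0#

  -- 1_L as an element of M (requires [k] ⊆ L): B = 0, D = \widetilde{1_L}
  𝟙 : Subset (k Data.Nat.+ m) → Elt
  𝟙 L = ⟦ (λ _ _ → 0#) , 𝟙̃ L ⟧

  T̄ : Subset (k Data.Nat.+ m) → (Fin m → F) → Set (c ⊔ ℓ)
  T̄ L d = ∃ λ (d′ : Fin m → F) →
            (∀ j → ∃ λ e → d′ j * e ≈ 1#) × (∀ j → d j ≈ d′ j * 𝟙̃ L j)

  -- Right groups: a subset S of M which is a subsemigroup, right simple
  -- (all elements are R-related in S, i.e. aS¹ = bS¹) and left cancellative.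
  IsRightGroup : (Elt → Set (c ⊔ ℓ)) → Set (c ⊔ ℓ)
  IsRightGroup S =
      (∀ a b → S a → S b → S (a · b))
    × (∀ a b → S a → S b → ∀ x →
         (x ≋ a ⊎ ∃ λ u → S u × x ≋ (a · u)) ⇔ (x ≋ b ⊎ ∃ λ v → S v × x ≋ (b · v)))
    × (∀ a b c′ → S a → S b → S c′ → (a · b) ≋ (a · c′) → b ≋ c′)

  -- B_Y (1_m - \widetilde{1_L}) = B_X (1_m - \widetilde{1_L})   (entrywise;
  -- right multiplication by a diagonal matrix scales columns)
  SameOffL : Subset (k Data.Nat.+ m) → Elt → Elt → Set ℓ
  SameOffL L Y X = ∀ i j → blk Y i j * (1# - 𝟙̃ L j) ≈ blk X i j * (1# - 𝟙̃ L j)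

{-# OPTIONS --safe #-}
-- If D_a ∈ T̄_L then D_a is invertible on the columns in L and zero off L, so a can be
-- divided by every x whose diagonal vanishes off L: aM = MaM = {x : D_x vanishes off L},
-- and Ma consists of those x whose block B_x moreover agrees with B_a off L.  Conversely,
-- if D_Y vanishes off L and divides D_X, the factorisation D_X = D′ 1̃_L forces D_Y ∈ T̄_L.  The same division makes J_X right simple, and J_X is
-- left cancellative because D_a is invertible on L, where the diagonals of J_X live.
module Submission where

open import Defs
open import Level using (_⊔_)
open import Algebra.Bundles using (CommutativeRing)
import Algebra.Properties.CommutativeSemigroup as CommutativeSemigroupProperties
import Algebra.Properties.Group as GroupProperties
open import Data.Nat using (ℕ)
import Data.Nat as Nat
open import Data.Fin using (Fin; _↑ʳ_)
open import Data.Fin.Subset using (Subset)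
open import Data.Vec using (lookup)
open import Data.Bool using (Bool; true; false; if_then_else_)
open import Data.Product using (∃; _×_; _,_; proj₁; proj₂)
open import Data.Sum using (_⊎_; inj₁; inj₂)
open import Function.Bundles using (_⇔_; mk⇔; Equivalence)
import Function.Properties.Equivalence as ⇔
import Relation.Binary.Reasoning.Setoid as SetoidReasoning

open Equivalence using (to; from)

module UnitMultiples {c ℓ} (R : CommutativeRing c ℓ) where
  open CommutativeRing R renaming (Carrier to F)
  open CommutativeSemigroupProperties *-commutativeSemigroup
    using (interchange; x∙yz≈y∙xz; xy∙z≈xz∙y)
  open GroupProperties +-group using (//-rightDividesˡ; ε⁻¹≈ε)
  open SetoidReasoning setoid

  IsUnit : F → Set (c ⊔ ℓ)
  IsUnit x = ∃ λ y → x * y ≈ 1#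

  isUnit-* : ∀ {x y} → IsUnit x → IsUnit y → IsUnit (x * y)
  isUnit-* {x} {y} (x⁻¹ , xx⁻¹≈1) (y⁻¹ , yy⁻¹≈1) = x⁻¹ * y⁻¹ , (begin
    (x * y) * (x⁻¹ * y⁻¹)  ≈⟨ interchange x y x⁻¹ y⁻¹ ⟩
    (x * x⁻¹) * (y * y⁻¹)  ≈⟨ *-cong xx⁻¹≈1 yy⁻¹≈1 ⟩
    1# * 1#                ≈⟨ *-identityˡ 1# ⟩
    1#                     ∎)

  indicator : Bool → F
  indicator b = if b then 1# else 0#

  indicator-idem : ∀ b → indicator b * indicator b ≈ indicator b
  indicator-idem true  = *-identityˡ 1#
  indicator-idem false = zeroˡ 0#

  indicator-complement : ∀ b → indicator b * (1# - indicator b) ≈ 0#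
  indicator-complement true  = trans (*-identityˡ _) (-‿inverseʳ 1#)
  indicator-complement false = zeroˡ _

  Supported : Bool → F → Set ℓ
  Supported b x = indicator b * x ≈ x

  supported-resp : ∀ {b x y} → x ≈ y → Supported b y → Supported b x
  supported-resp x≈y s = trans (*-congˡ x≈y) (trans s (sym x≈y))

  supported-*ʳ : ∀ {b x} y → Supported b x → Supported b (x * y)
  supported-*ʳ {b} {x} y s = trans (sym (*-assoc (indicator b) x y)) (*-congʳ s)

  supported-*ˡ : ∀ {b y} x → Supported b y → Supported b (x * y)
  supported-*ˡ {b} {y} x s = trans (x∙yz≈y∙xz (indicator b) x y) (*-congˡ s)

  UnitMultiple : Bool → F → Set (c ⊔ ℓ)
  UnitMultiple b x = ∃ λ u → IsUnit u × x ≈ u * indicator b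

  unitMultiple⇒supported : ∀ {b x} → UnitMultiple b x → Supported b x
  unitMultiple⇒supported {b} {x} (u , _ , x≈ut) = begin
    t * x        ≈⟨ *-congˡ x≈ut ⟩
    t * (u * t)  ≈⟨ x∙yz≈y∙xz t u t ⟩
    u * (t * t)  ≈⟨ *-congˡ (indicator-idem b) ⟩
    u * t        ≈⟨ sym x≈ut ⟩
    x            ∎
    where t = indicator b

  unitMultiple-* : ∀ {b x y} → UnitMultiple b x → UnitMultiple b y → UnitMultiple b (x * y)
  unitMultiple-* {b} {x} {y} (u , u-unit , x≈ut) (v , v-unit , y≈vt) =
    u * v , isUnit-* u-unit v-unit , (begin
      x * y              ≈⟨ *-cong x≈ut y≈vt ⟩
      (u * t) * (v * t)  ≈⟨ interchange u t v t ⟩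
      (u * v) * (t * t)  ≈⟨ *-congˡ (indicator-idem b) ⟩
      (u * v) * t        ∎)
    where t = indicator b

  isUnit*unitMultiple : ∀ {b v y} → IsUnit v → UnitMultiple b y → UnitMultiple b (v * y)
  isUnit*unitMultiple {b} {v} v-unit (u , u-unit , y≈ut) =
    v * u , isUnit-* v-unit u-unit , trans (*-congˡ y≈ut) (sym (*-assoc v u (indicator b)))

  unitMultiple*complement : ∀ {b x} → UnitMultiple b x → x * (1# - indicator b) ≈ 0#
  unitMultiple*complement {b} {x} (u , _ , x≈ut) = begin
    x * (1# - t)        ≈⟨ *-congʳ x≈ut ⟩
    (u * t) * (1# - t)  ≈⟨ *-assoc u t (1# - t) ⟩
    u * (t * (1# - t))  ≈⟨ *-congˡ (indicator-complement b) ⟩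
    u * 0#              ≈⟨ zeroʳ u ⟩
    0#                  ∎
    where t = indicator b

  pinv : ∀ {b x} → UnitMultiple b x → F
  pinv (_ , (u⁻¹ , _) , _) = u⁻¹

  pinv-isUnit : ∀ {b x} (p : UnitMultiple b x) → IsUnit (pinv p)
  pinv-isUnit (u , (u⁻¹ , uu⁻¹≈1) , _) = u , trans (*-comm u⁻¹ u) uu⁻¹≈1

  *-pinv : ∀ {b x} (p : UnitMultiple b x) → x * pinv p ≈ indicator b
  *-pinv {b} {x} (u , (u⁻¹ , uu⁻¹≈1) , x≈ut) = begin
    x * u⁻¹        ≈⟨ *-congʳ x≈ut ⟩
    (u * t) * u⁻¹  ≈⟨ xy∙z≈xz∙y u t u⁻¹ ⟩
    (u * u⁻¹) * t  ≈⟨ *-congʳ uu⁻¹≈1 ⟩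
    1# * t         ≈⟨ *-identityˡ t ⟩
    t              ∎
    where t = indicator b

  *-pinv-* : ∀ {b x y} (p : UnitMultiple b x) → Supported b y → x * (pinv p * y) ≈ y
  *-pinv-* {x = x} {y} p s = trans (sym (*-assoc x (pinv p) y)) (trans (*-congʳ (*-pinv p)) s)

  unitMultiple-cancelˡ : ∀ {b x y z} → UnitMultiple b x → Supported b y → Supported b z →
                         x * y ≈ x * z → y ≈ z
  unitMultiple-cancelˡ {b} {x} {y} {z} p sy sz xy≈xz = begin
    y                  ≈⟨ sy ⟨
    indicator b * y    ≈⟨ *-congʳ (*-pinv p) ⟨
    (x * x⁻) * y       ≈⟨ xy∙z≈xz∙y x x⁻ y ⟩
    (x * y) * x⁻       ≈⟨ *-congʳ xy≈xz ⟩
    (x * z) * x⁻       ≈⟨ xy∙z≈xz∙y x z x⁻ ⟩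
    (x * x⁻) * z       ≈⟨ *-congʳ (*-pinv p) ⟩
    indicator b * z    ≈⟨ sz ⟩
    z                  ∎
    where x⁻ = pinv p

  unitMultiple-divisor : ∀ b {x y w} → UnitMultiple b x → Supported b y → x ≈ y * w →
                         UnitMultiple b y
  unitMultiple-divisor true {x} {y} {w} p _ x≈yw = y , (w * x⁻ , (begin
    y * (w * x⁻)  ≈⟨ *-assoc y w x⁻ ⟨
    (y * w) * x⁻  ≈⟨ *-congʳ x≈yw ⟨
    x * x⁻        ≈⟨ *-pinv {true} p ⟩
    1#            ∎)) , sym (*-identityʳ y)
    where x⁻ = pinv {true} p
  unitMultiple-divisor false {y = y} _ sy _ =
    1# , (1# , *-identityˡ 1#) , trans (sym sy) (trans (zeroˡ y) (sym (zeroʳ 1#)))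

  agreeOff⇒≈ : ∀ b {x y} → x * (1# - indicator b) ≈ y * (1# - indicator b) →
               x ≈ y + (x - y) * indicator b
  agreeOff⇒≈ true {x} {y} _ = sym (begin
    y + (x - y) * 1#  ≈⟨ +-congˡ (*-identityʳ (x - y)) ⟩
    y + (x - y)       ≈⟨ +-comm y (x - y) ⟩
    (x - y) + y       ≈⟨ //-rightDividesˡ y x ⟩
    x                 ∎)
  agreeOff⇒≈ false {x} {y} x≈y-off = begin
    x                 ≈⟨ *[1-0] x ⟨
    x * (1# - 0#)     ≈⟨ x≈y-off ⟩
    y * (1# - 0#)     ≈⟨ *[1-0] y ⟩
    y                 ≈⟨ +-identityʳ y ⟨
    y + 0#            ≈⟨ +-congˡ (zeroʳ (x - y)) ⟨
    y + (x - y) * 0#  ∎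
    where
    *[1-0] : ∀ z → z * (1# - 0#) ≈ z
    *[1-0] z = trans (*-congˡ (trans (+-congˡ ε⁻¹≈ε) (+-identityʳ 1#))) (*-identityʳ z)

module PrincipalIdeals {c ℓ} (R : CommutativeRing c ℓ) (k m : ℕ) where
  open CommutativeRing R
  open Bipartite R k m

  1ᴹ : Elt
  1ᴹ = ⟦ (λ _ _ → 0#) , (λ _ → 1#) ⟧

  ≋-sym : ∀ {a b} → a ≋ b → b ≋ a
  ≋-sym (p , q) = (λ i j → sym (p i j)) , (λ j → sym (q j))

  ≋-trans : ∀ {a b d} → a ≋ b → b ≋ d → a ≋ d
  ≋-trans (p , q) (p′ , q′) = (λ i j → trans (p i j) (p′ i j)) , (λ j → trans (q j) (q′ j))

  ·-congʳ : ∀ {a a′ v} → a ≋ a′ → (a · v) ≋ (a′ · v)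
  ·-congʳ (p , q) = (λ i j → +-congˡ (*-congʳ (p i j))) , (λ j → *-congʳ (q j))

  ·-identityˡ : ∀ a → (1ᴹ · a) ≋ a
  ·-identityˡ a = (λ i j → trans (+-congˡ (zeroˡ _)) (+-identityʳ _)) , (λ j → *-identityˡ _)

  ·-identityʳ : ∀ a → (a · 1ᴹ) ≋ a
  ·-identityʳ a = (λ i j → trans (+-identityˡ _) (*-identityʳ _)) , (λ j → *-identityʳ _)

  ⟨_⟩ʳ ⟨_⟩ˡ ⟨_⟩ : Elt → Elt → Set (c ⊔ ℓ)
  ⟨ a ⟩ʳ x = ∃ λ u → x ≋ (a · u)
  ⟨ a ⟩ˡ x = ∃ λ u → x ≋ (u · a)
  ⟨ a ⟩ x = ∃ λ u → ∃ λ v → x ≋ ((u · a) · v)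

  ∈⟨⟩ʳ : ∀ a → ⟨ a ⟩ʳ a
  ∈⟨⟩ʳ a = 1ᴹ , ≋-sym (·-identityʳ a)

  ∈⟨⟩ˡ : ∀ a → ⟨ a ⟩ˡ a
  ∈⟨⟩ˡ a = 1ᴹ , ≋-sym (·-identityˡ a)

  ∈⟨⟩ : ∀ a → ⟨ a ⟩ a
  ∈⟨⟩ a = 1ᴹ , 1ᴹ , ≋-sym (≋-trans (·-identityʳ (1ᴹ · a)) (·-identityˡ a))

  _∣ᵈ_ : Elt → Elt → Set (c ⊔ ℓ)
  a ∣ᵈ b = ∀ j → ∃ λ w → dia b j ≈ dia a j * w

  ⟨⟩ʳ⇒∣ᵈ : ∀ {a x} → ⟨ a ⟩ʳ x → a ∣ᵈ x
  ⟨⟩ʳ⇒∣ᵈ (u , x≋au) j = dia u j , proj₂ x≋au j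

  ⟨⟩ˡ⇒∣ᵈ : ∀ {a x} → ⟨ a ⟩ˡ x → a ∣ᵈ x
  ⟨⟩ˡ⇒∣ᵈ (u , x≋ua) j = dia u j , trans (proj₂ x≋ua j) (*-comm _ _)

  ⟨⟩⇒∣ᵈ : ∀ {a x} → ⟨ a ⟩ x → a ∣ᵈ x
  ⟨⟩⇒∣ᵈ (u , v , x≋uav) j =
    dia u j * dia v j , trans (proj₂ x≋uav j) (trans (*-congʳ (*-comm _ _)) (*-assoc _ _ _))

module GreenRelations {c ℓ} (R : CommutativeRing c ℓ) (k m : ℕ) (L : Subset (k Nat.+ m)) where
  open CommutativeRing R renaming (Carrier to F)
  open GroupProperties +-group using (//-rightDividesˡ; ∙-cancelʳ)
  open SetoidReasoning setoid
  open UnitMultiples R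
  open Bipartite R k m
  open PrincipalIdeals R k m

  inL : Fin m → Bool
  inL j = lookup L (k ↑ʳ j)

  SupportedOnL : Elt → Set ℓ
  SupportedOnL a = ∀ j → Supported (inL j) (dia a j)

  T̄⇔pointwise : ∀ {d} → T̄ L d ⇔ (∀ j → UnitMultiple (inL j) (d j))
  T̄⇔pointwise = mk⇔
    (λ (d′ , units , d≈d′𝟙̃) j → d′ j , units j , d≈d′𝟙̃ j)
    (λ h → (λ j → proj₁ (h j)) , (λ j → proj₁ (proj₂ (h j))) , (λ j → proj₂ (proj₂ (h j))))

  T̄⇒supportedOnL : ∀ a → T̄ L (dia a) → SupportedOnL a
  T̄⇒supportedOnL _ Ta j = unitMultiple⇒supported (to T̄⇔pointwise Ta j)

  supportedOnL-resp : ∀ {a b} → a ≋ b → SupportedOnL b → SupportedOnL a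
  supportedOnL-resp (_ , a≈b) s j = supported-resp (a≈b j) (s j)

  supportedOnL-·ʳ : ∀ a u → SupportedOnL a → SupportedOnL (a · u)
  supportedOnL-·ʳ _ u s j = supported-*ʳ (dia u j) (s j)

  supportedOnL-·ˡ : ∀ u a → SupportedOnL a → SupportedOnL (u · a)
  supportedOnL-·ˡ u _ s j = supported-*ˡ (dia u j) (s j)

  T̄-resp : ∀ {a b} → a ≋ b → T̄ L (dia b) → T̄ L (dia a)
  T̄-resp (_ , a≈b) (d′ , units , b≈d′𝟙̃) = d′ , units , (λ j → trans (a≈b j) (b≈d′𝟙̃ j))

  T̄-· : ∀ a b → T̄ L (dia a) → T̄ L (dia b) → T̄ L (dia (a · b))
  T̄-· _ _ Ta Tb = from T̄⇔pointwise (λ j →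
    unitMultiple-* (to T̄⇔pointwise Ta j) (to T̄⇔pointwise Tb j))

  T̄-𝟙 : T̄ L (dia (𝟙 L))
  T̄-𝟙 = (λ _ → 1#) , (λ _ → 1# , *-identityˡ 1#) , (λ j → sym (*-identityˡ _))

  T̄-divisor : ∀ a b → T̄ L (dia a) → SupportedOnL b → b ∣ᵈ a → T̄ L (dia b)
  T̄-divisor _ _ Ta sb b∣a = from T̄⇔pointwise (λ j →
    unitMultiple-divisor (inL j) (to T̄⇔pointwise Ta j) (sb j) (proj₂ (b∣a j)))

  module Quotients (a : Elt) (Ta : T̄ L (dia a)) where
    a⁻ : Fin m → F
    a⁻ j = pinv (to T̄⇔pointwise Ta j)

    rightQuotient : Elt → Elt
    rightQuotient x = ⟦ (λ i j → blk x i j - blk a i j * (a⁻ j * dia x j)) , (λ j → a⁻ j * dia x j) ⟧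

    rightQuotient-correct : ∀ x → SupportedOnL x → x ≋ (a · rightQuotient x)
    rightQuotient-correct x s =
      (λ i j → sym (//-rightDividesˡ _ _)) ,
      (λ j → sym (*-pinv-* (to T̄⇔pointwise Ta j) (s j)))

    rightQuotient-T̄ : ∀ x → T̄ L (dia x) → T̄ L (dia (rightQuotient x))
    rightQuotient-T̄ _ Tx = from T̄⇔pointwise (λ j →
      isUnit*unitMultiple (pinv-isUnit (to T̄⇔pointwise Ta j)) (to T̄⇔pointwise Tx j))

    leftQuotient : Elt → Elt
    leftQuotient x = ⟦ (λ i j → (blk x i j - blk a i j) * a⁻ j) , (λ j → a⁻ j * dia x j) ⟧

    leftQuotient-correct : ∀ x → SupportedOnL x → SameOffL L x a → x ≋ (leftQuotient x · a)
    leftQuotient-correct x s x≈a-off = blk-correct , dia-correct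
      where
      blk-correct : ∀ i j → blk x i j ≈ blk (leftQuotient x · a) i j
      blk-correct i j = begin
        blk x i j                                   ≈⟨ agreeOff⇒≈ (inL j) (x≈a-off i j) ⟩
        blk a i j + δ * 𝟙̃ L j                      ≈⟨ +-congˡ (*-congˡ (*-pinv (to T̄⇔pointwise Ta j))) ⟨
        blk a i j + δ * (dia a j * a⁻ j)            ≈⟨ +-congˡ (*-congˡ (*-comm _ _)) ⟩
        blk a i j + δ * (a⁻ j * dia a j)            ≈⟨ +-congˡ (*-assoc δ _ _) ⟨
        blk a i j + (δ * a⁻ j) * dia a j            ∎
        where δ = blk x i j - blk a i j

      dia-correct : ∀ j → dia x j ≈ (a⁻ j * dia x j) * dia a j
      dia-correct j = sym (trans (*-comm _ _) (*-pinv-* (to T̄⇔pointwise Ta j) (s j)))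

    -- Right multiplication by a leaves the columns of B off L untouched, since D_a vanishes there.
    sameOffL-·ˡ : ∀ u → SameOffL L (u · a) a
    sameOffL-·ˡ u i j = begin
      (blk a i j + blk u i j * dia a j) * c′          ≈⟨ distribʳ c′ (blk a i j) _ ⟩
      blk a i j * c′ + (blk u i j * dia a j) * c′     ≈⟨ +-congˡ (*-assoc (blk u i j) _ c′) ⟩
      blk a i j * c′ + blk u i j * (dia a j * c′)     ≈⟨ +-congˡ (*-congˡ
                                                           (unitMultiple*complement (to T̄⇔pointwise Ta j))) ⟩
      blk a i j * c′ + blk u i j * 0#                 ≈⟨ +-congˡ (zeroʳ _) ⟩
      blk a i j * c′ + 0#                             ≈⟨ +-identityʳ _ ⟩
      blk a i j * c′                                  ∎
      where c′ = 1# - 𝟙̃ L j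

    ·-cancelˡ : ∀ {b b′} → SupportedOnL b → SupportedOnL b′ → (a · b) ≋ (a · b′) → b ≋ b′
    ·-cancelˡ {b} {b′} sb sb′ (blk≈ , dia≈) = blk-cancel , dia-cancel
      where
      dia-cancel : ∀ j → dia b j ≈ dia b′ j
      dia-cancel j = unitMultiple-cancelˡ (to T̄⇔pointwise Ta j) (sb j) (sb′ j) (dia≈ j)

      blk-cancel : ∀ i j → blk b i j ≈ blk b′ i j
      blk-cancel i j = ∙-cancelʳ (blk a i j * dia b j) _ _
        (trans (blk≈ i j) (+-congˡ (*-congˡ (sym (dia-cancel j)))))

  principalʳ-char : ∀ {a} → T̄ L (dia a) → ∀ x → ⟨ a ⟩ʳ x ⇔ SupportedOnL x
  principalʳ-char {a} Ta x = mk⇔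
    (λ (u , x≋au) → supportedOnL-resp x≋au (supportedOnL-·ʳ a u (T̄⇒supportedOnL a Ta)))
    (λ s → rightQuotient x , rightQuotient-correct x s)
    where open Quotients a Ta

  principal-char : ∀ {a} → T̄ L (dia a) → ∀ x → ⟨ a ⟩ x ⇔ SupportedOnL x
  principal-char {a} Ta x = mk⇔
    (λ (u , v , x≋uav) →
      supportedOnL-resp x≋uav (supportedOnL-·ʳ (u · a) v (supportedOnL-·ˡ u a (T̄⇒supportedOnL a Ta))))
    (λ s → 1ᴹ , rightQuotient x ,
      ≋-trans (rightQuotient-correct x s) (·-congʳ (≋-sym (·-identityˡ a))))
    where open Quotients a Ta

  principalˡ-char : ∀ {a} → T̄ L (dia a) → ∀ x → ⟨ a ⟩ˡ x ⇔ (SupportedOnL x × SameOffL L x a)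
  principalˡ-char {a} Ta x = mk⇔
    (λ (u , x≋ua) →
      supportedOnL-resp x≋ua (supportedOnL-·ˡ u a (T̄⇒supportedOnL a Ta)) ,
      (λ i j → trans (*-congʳ (proj₁ x≋ua i j)) (sameOffL-·ˡ u i j)))
    (λ (s , x≈a-off) → leftQuotient x , leftQuotient-correct x s x≈a-off)
    where open Quotients a Ta

  𝓡-char : ∀ {X} → T̄ L (dia X) → ∀ Y → (X 𝓡 Y) ⇔ T̄ L (dia Y)
  𝓡-char {X} TX Y = mk⇔
    (λ X𝓡Y → T̄-divisor X Y TX
      (to (principalʳ-char TX Y) (from (X𝓡Y Y) (∈⟨⟩ʳ Y)))
      (⟨⟩ʳ⇒∣ᵈ (to (X𝓡Y X) (∈⟨⟩ʳ X))))
    (λ TY x → ⇔.trans (principalʳ-char TX x) (⇔.sym (principalʳ-char TY x)))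

  𝓙-char : ∀ {X} → T̄ L (dia X) → ∀ Y → (X 𝓙 Y) ⇔ T̄ L (dia Y)
  𝓙-char {X} TX Y = mk⇔
    (λ X𝓙Y → T̄-divisor X Y TX
      (to (principal-char TX Y) (from (X𝓙Y Y) (∈⟨⟩ Y)))
      (⟨⟩⇒∣ᵈ (to (X𝓙Y X) (∈⟨⟩ X))))
    (λ TY x → ⇔.trans (principal-char TX x) (⇔.sym (principal-char TY x)))

  𝓛-char : ∀ {X} → T̄ L (dia X) → ∀ Y → (X 𝓛 Y) ⇔ (SameOffL L Y X × T̄ L (dia Y))
  𝓛-char {X} TX Y = mk⇔
    (λ X𝓛Y →
      let Y∈MX = to (principalˡ-char TX Y) (from (X𝓛Y Y) (∈⟨⟩ˡ Y))
      in proj₂ Y∈MX , T̄-divisor X Y TX (proj₁ Y∈MX) (⟨⟩ˡ⇒∣ᵈ (to (X𝓛Y X) (∈⟨⟩ˡ X))))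
    (λ (Y≈X-off , TY) x → mk⇔
      (λ x∈MX → let (s , x≈X-off) = to (principalˡ-char TX x) x∈MX
                in from (principalˡ-char TY x) (s , λ i j → trans (x≈X-off i j) (sym (Y≈X-off i j))))
      (λ x∈MY → let (s , x≈Y-off) = to (principalˡ-char TY x) x∈MY
                in from (principalˡ-char TX x) (s , λ i j → trans (x≈Y-off i j) (Y≈X-off i j))))

  𝓛⇔𝓗 : ∀ {X} → T̄ L (dia X) → ∀ Y → (X 𝓛 Y) ⇔ (X 𝓗 Y)
  𝓛⇔𝓗 TX Y = mk⇔ (λ X𝓛Y → from (𝓡-char TX Y) (proj₂ (to (𝓛-char TX Y) X𝓛Y)) , X𝓛Y) proj₂

  𝓗-char : ∀ {X} → T̄ L (dia X) → ∀ Y → (X 𝓗 Y) ⇔ (SameOffL L Y X × T̄ L (dia Y))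
  𝓗-char TX Y = ⇔.trans (⇔.sym (𝓛⇔𝓗 TX Y)) (𝓛-char TX Y)

  𝓓-char : ∀ {X} → T̄ L (dia X) → ∀ Y → (X 𝓓 Y) ⇔ T̄ L (dia Y)
  𝓓-char TX Y = mk⇔
    (λ (Z , X𝓡Z , Z𝓛Y) → proj₂ (to (𝓛-char (to (𝓡-char TX Z) X𝓡Z) Y) Z𝓛Y))
    (λ TY → Y , from (𝓡-char TX Y) TY , (λ _ → ⇔.refl))

  T̄-isRightGroup : (S : Elt → Set (c ⊔ ℓ)) → (∀ Y → S Y ⇔ T̄ L (dia Y)) → IsRightGroup S
  T̄-isRightGroup S S⇔T̄ = closed , rightSimple , leftCancellative
    where
    closed : ∀ a b → S a → S b → S (a · b)
    closed a b Sa Sb = from (S⇔T̄ (a · b)) (T̄-· a b (to (S⇔T̄ a) Sa) (to (S⇔T̄ b) Sb))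

    rightIdeal⇔T̄ : ∀ a → S a → ∀ x → (x ≋ a ⊎ ∃ λ u → S u × x ≋ (a · u)) ⇔ T̄ L (dia x)
    rightIdeal⇔T̄ a Sa x = mk⇔
      (λ { (inj₁ x≋a) → T̄-resp x≋a Ta
         ; (inj₂ (u , Su , x≋au)) → T̄-resp x≋au (T̄-· a u Ta (to (S⇔T̄ u) Su)) })
      (λ Tx → inj₂ (rightQuotient x , from (S⇔T̄ _) (rightQuotient-T̄ x Tx) ,
                    rightQuotient-correct x (T̄⇒supportedOnL x Tx)))
      where
      Ta : T̄ L (dia a)
      Ta = to (S⇔T̄ a) Sa
      open Quotients a Ta

    rightSimple : ∀ a b → S a → S b → ∀ x →
      (x ≋ a ⊎ ∃ λ u → S u × x ≋ (a · u)) ⇔ (x ≋ b ⊎ ∃ λ v → S v × x ≋ (b · v))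
    rightSimple a b Sa Sb x = ⇔.trans (rightIdeal⇔T̄ a Sa x) (⇔.sym (rightIdeal⇔T̄ b Sb x))

    leftCancellative : ∀ a b b′ → S a → S b → S b′ → (a · b) ≋ (a · b′) → b ≋ b′
    leftCancellative a b b′ Sa Sb Sb′ =
      ·-cancelˡ (T̄⇒supportedOnL b (to (S⇔T̄ b) Sb)) (T̄⇒supportedOnL b′ (to (S⇔T̄ b′) Sb′))
      where open Quotients a (to (S⇔T̄ a) Sa)

open import Data.Nat using (_+_; NonZero)

theorem6p2 : ∀ {c ℓ} (R : CommutativeRing c ℓ) → IsField R →
    (k m : ℕ) → NonZero k → NonZero m →
    let open Bipartite R k m in (L : Subset (k + m)) → ContainsTop L →
       (X : Elt) → T̄ L (dia X) →
       -- (1)  J_X = D_X = R_X = {Y : D_Y ∈ T̄_L} = J_{1_L}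
       (∀ Y → ((X 𝓙 Y) ⇔ (X 𝓓 Y)) × ((X 𝓓 Y) ⇔ (X 𝓡 Y))
              × ((X 𝓡 Y) ⇔ T̄ L (dia Y)) × (T̄ L (dia Y) ⇔ (𝟙 L 𝓙 Y)))
       -- (2)  L_X = H_X = {Y : B_Y(1 - 1̃_L) = B_X(1 - 1̃_L), D_Y ∈ T̄_L}
       × (∀ Y → ((X 𝓛 Y) ⇔ (X 𝓗 Y))
              × ((X 𝓗 Y) ⇔
                  (SameOffL L Y X × T̄ L (dia Y))))
       -- (3)  J_X is a right group
       × IsRightGroup (λ Y → X 𝓙 Y)
theorem6p2 R _ k m _ _ L _ X TX =
  (λ Y → ⇔.trans (𝓙-char TX Y) (⇔.sym (𝓓-char TX Y))
       , ⇔.trans (𝓓-char TX Y) (⇔.sym (𝓡-char TX Y))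
       , 𝓡-char TX Y
       , ⇔.sym (𝓙-char T̄-𝟙 Y))
  , (λ Y → 𝓛⇔𝓗 TX Y , 𝓗-char TX Y)
  , T̄-isRightGroup (X 𝓙_) (𝓙-char TX)
  where
  open Bipartite R k m
  open GreenRelations R k m L
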